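{- If $A$ is a cycle-free atomic flow and $A\to_{\mathsf c}^\star B$, then $B$ is cycle-free.
   Context: An atomic flow is a finite directed acyclic graph whose vertices are labelled interaction (0 upper edges, 2 lower edges), cointeraction (2 upper, 0 lower), weakening (0,1), coweakening (1,0), contraction (2,1) or cocontraction (1,2); edges may also have a dangling upper or lower end (upper/lower edges of the flow); there is a polarity assignment in $\{+,-\}$ with equal polarities on the edges of a (co)contraction and distinct ones on the two edges of a (co)interaction. A path is a sequence of edges $\epsilon_1,\dots,\epsilon_h$ where the lower end of $\epsilon_i$ is the upper end of $\epsilon_{i+1}$, or the reverse of such a sequence. An $\mathsf{ai}$-path is either a path or (recursively) the concatenation $\epsilon_1,\dots,\epsilon_k,\epsilon_{k+1},\dots,\epsilon_h$ of an $\mathsf{ai}$-path ending at an interaction or cointeraction vertex $\nu$ and an $\mathsf{ai}$-path starting at $\nu$, with $\epsilon_k\neq\epsilon_{k+1}$. An $\mathsf{ai}$-cycle is an $\mathsf{ai}$-path from a vertex to itself in which no edge appears twice. A flow is cycle-free if it contains no $\mathsf{ai}$-cycle. System $\mathsf c$ consists of three local rules (keeping boundary edges): (1) a contraction with upper edges $\epsilon_1,\epsilon_2$ whose lower edge is an upper edge of a cointeraction with other upper edge $\epsilon_3$ is replaced by a cocontraction with upper edge $\epsilon_3$ and lower edges $\delta_1,\delta_2$ and two cointeractions with upper edges $\{\epsilon_1,\delta_1\}$ and $\{\epsilon_2,\delta_2\}$; (2) an interaction with lower edges $\epsilon_3,\epsilon$, where $\epsilon$ is the upper edge of a cocontraction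 with lower edges $\epsilon_1,\epsilon_2$, is replaced by a contraction with lower edge $\epsilon_3$ and upper edges $\delta_1,\delta_2$ and two interactions with lower edges $\{\epsilon_1,\delta_1\}$, $\{\epsilon_2,\delta_2\}$; (3) a contraction with upper edges $\epsilon_1,\epsilon_2$ whose lower edge is the upper edge of a cocontraction with lower edges $\epsilon_3,\epsilon_4$ is replaced by two cocontractions with upper edges $\epsilon_1,\epsilon_2$ and two contractions with lower edges $\epsilon_3,\epsilon_4$, with one new edge from each cocontraction to each contraction. $\to_{\mathsf c}^\star$ is the reflexive–transitive closure of one-step rewriting by these rules. -}

module Defs where

open import Data.Nat using (ℕ)
open import Data.Fin using (Fin; _≟_) renaming (zero to 0F)
open import Data.Fin.Patterns using (1F; 2F; 3F)
open import Data.Maybe using (Maybe; just; nothing)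
import Data.Maybe.Properties as MP
open import Data.List using (List; []; _∷_; _∷ʳ_; _++_; reverse; length; filter; allFin)
open import Data.Bool.ListAction using (any)
open import Data.List.Relation.Unary.Unique.Propositional using (Unique)
open import Data.Bool using (Bool; T; not)
open import Data.Product using (Σ; ∃; ∃-syntax; _×_; _,_; proj₁)
open import Data.Sum using (_⊎_; inj₁; inj₂)
open import Data.Empty using (⊥)
open import Relation.Nullary using (¬_; Dec)
open import Relation.Nullary.Decidable using (⌊_⌋)
open import Relation.Binary.PropositionalEquality using (_≡_; _≢_)
open import Relation.Binary.Construct.Closure.ReflexiveTransitive using (Star)
open import Function.Bundles using (_↔_; Inverse)

data Kind : Set where
  interaction cointeraction weakening coweakening contraction cocontraction : Kind

upArity : Kind → ℕ
upArity interaction   = 0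
upArity cointeraction = 2
upArity weakening     = 0
upArity coweakening   = 1
upArity contraction   = 2
upArity cocontraction = 1

lowArity : Kind → ℕ
lowArity interaction   = 2
lowArity cointeraction = 0
lowArity weakening     = 1
lowArity coweakening   = 0
lowArity contraction   = 1
lowArity cocontraction = 2

data IsAI : Kind → Set where
  int   : IsAI interaction
  coint : IsAI cointeraction

data IsC : Kind → Set where
  con   : IsC contraction
  cocon : IsC cocontraction

data Polarity : Set where
  pos neg : Polarity

-- Each edge has an upper end
-- `top e` and a lower end `bot e`; `nothing` = dangling end.
-- An edge e with  top e ≡ just v  is a LOWER edge of v,
-- an edge e with  bot e ≡ just v  is an UPPER edge of v.

data DownPath {V E : ℕ} (top bot : Fin E → Maybe (Fin V))
     : Maybe (Fin V) → Maybe (Fin V) → List (Fin E) → Set where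
  single : ∀ e → DownPath top bot (top e) (bot e) (e ∷ [])
  cons   : ∀ {v y es} e → bot e ≡ just v → DownPath top bot (just v) y es →
           DownPath top bot (top e) y (e ∷ es)

_≟ᵐ_ : ∀ {n} (x y : Maybe (Fin n)) → Dec (x ≡ y)
_≟ᵐ_ = MP.≡-dec _≟_

record Flow : Set where
  field
    V E  : ℕ
    kind : Fin V → Kind
    top  : Fin E → Maybe (Fin V)
    bot  : Fin E → Maybe (Fin V)
    pol  : Fin E → Polarity
    upper-arity : ∀ v → length (filter (λ e → bot e ≟ᵐ just v) (allFin E))
                         ≡ upArity (kind v)
    lower-arity : ∀ v → length (filter (λ e → top e ≟ᵐ just v) (allFin E))
                         ≡ lowArity (kind v)
    pol-C  : ∀ v e e' → IsC (kind v) →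
             (top e ≡ just v ⊎ bot e ≡ just v) → (top e' ≡ just v ⊎ bot e' ≡ just v) →
             pol e ≡ pol e'
    pol-AI : ∀ v e e' → IsAI (kind v) →
             (top e ≡ just v ⊎ bot e ≡ just v) → (top e' ≡ just v ⊎ bot e' ≡ just v) →
             e ≢ e' → pol e ≢ pol e'
    acyclic : ∀ v es → ¬ DownPath top bot (just v) (just v) es

open Flow

Path : (F : Flow) → Maybe (Fin (V F)) → Maybe (Fin (V F)) → List (Fin (E F)) → Set
Path F x y es = DownPath (top F) (bot F) x y es ⊎ DownPath (top F) (bot F) y x (reverse es)

data AIPath (F : Flow) : Maybe (Fin (V F)) → Maybe (Fin (V F)) → List (Fin (E F)) → Set where
  path : ∀ {x y es} → Path F x y es → AIPath F x y es
  join : ∀ {x y ν es e f fs} →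
         AIPath F x (just ν) (es ∷ʳ e) → AIPath F (just ν) y (f ∷ fs) →
         IsAI (kind F ν) → e ≢ f →
         AIPath F x y ((es ∷ʳ e) ++ (f ∷ fs))

AICycle : Flow → Set
AICycle F = ∃[ v ] ∃[ es ] (AIPath F (just v) (just v) es × Unique es)

CycleFree : Flow → Set
CycleFree F = ¬ AICycle F

memb : ∀ {n} → Fin n → List (Fin n) → Bool
memb v xs = any (λ w → ⌊ v ≟ w ⌋) xs

Kept : ∀ {n} → List (Fin n) → Set
Kept {n} xs = Σ (Fin n) (λ v → T (not (memb v xs)))

-- B is obtained from A by deleting the vertices redV and the edges redE,
-- and adding nV new vertices and nE new edges.  Vertices/edges of B are in
-- bijection with (kept ones of A) ⊎ (new ones); kept vertices keep their
-- label, kept edges keep their polarity and those of their ends that are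
-- dangling or at kept vertices.  (Ends at deleted vertices, labels of new
-- vertices and ends of new edges are specified by each rule.)
record Replacement (A B : Flow) (redV : List (Fin (V A))) (redE : List (Fin (E A)))
                   (nV nE : ℕ) : Set where
  field
    isoV : (Kept redV ⊎ Fin nV) ↔ Fin (V B)
    isoE : (Kept redE ⊎ Fin nE) ↔ Fin (E B)
  vB : Kept redV ⊎ Fin nV → Fin (V B)
  vB = Inverse.to isoV
  eB : Kept redE ⊎ Fin nE → Fin (E B)
  eB = Inverse.to isoE
  field
    kind-kept : ∀ (v : Kept redV) → kind B (vB (inj₁ v)) ≡ kind A (proj₁ v)
    pol-kept  : ∀ (e : Kept redE) → pol B (eB (inj₁ e)) ≡ pol A (proj₁ e)
    top-dang  : ∀ (e : Kept redE) → top A (proj₁ e) ≡ nothing → top B (eB (inj₁ e)) ≡ nothing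
    bot-dang  : ∀ (e : Kept redE) → bot A (proj₁ e) ≡ nothing → bot B (eB (inj₁ e)) ≡ nothing
    top-kept  : ∀ (e : Kept redE) (v : Kept redV) → top A (proj₁ e) ≡ just (proj₁ v) →
                top B (eB (inj₁ e)) ≡ just (vB (inj₁ v))
    bot-kept  : ∀ (e : Kept redE) (v : Kept redV) → bot A (proj₁ e) ≡ just (proj₁ v) →
                bot B (eB (inj₁ e)) ≡ just (vB (inj₁ v))

-- (1) contraction c (upper edges ε₁ ε₂, lower edge ε) above cointeraction k
--     (upper edges ε, ε₃)  ⟶  cocontraction n0 (upper ε₃, lower δ₁ δ₂),
--     cointeractions n1 (upper ε₁ δ₁), n2 (upper ε₂ δ₂).
record Rule1 (A B : Flow) : Set where
  field
    c k : Fin (V A)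
    ε ε₁ ε₂ ε₃ : Fin (E A)
    c-kind : kind A c ≡ contraction
    k-kind : kind A k ≡ cointeraction
    ε-top  : top A ε ≡ just c
    ε-bot  : bot A ε ≡ just k
    ε₁-bot : bot A ε₁ ≡ just c
    ε₂-bot : bot A ε₂ ≡ just c
    ε₁≢ε₂  : ε₁ ≢ ε₂
    ε₃-bot : bot A ε₃ ≡ just k
    ε₃≢ε   : ε₃ ≢ ε
    rep    : Replacement A B (c ∷ k ∷ []) (ε ∷ []) 3 2
  open Replacement rep
  field
    n0-kind : kind B (vB (inj₂ 0F)) ≡ cocontraction
    n1-kind : kind B (vB (inj₂ 1F)) ≡ cointeraction
    n2-kind : kind B (vB (inj₂ 2F)) ≡ cointeraction
    δ₁-top  : top B (eB (inj₂ 0F)) ≡ just (vB (inj₂ 0F))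
    δ₁-bot  : bot B (eB (inj₂ 0F)) ≡ just (vB (inj₂ 1F))
    δ₂-top  : top B (eB (inj₂ 1F)) ≡ just (vB (inj₂ 0F))
    δ₂-bot  : bot B (eB (inj₂ 1F)) ≡ just (vB (inj₂ 2F))
    ε₁-bot' : ∀ (e : Kept (ε ∷ [])) → proj₁ e ≡ ε₁ → bot B (eB (inj₁ e)) ≡ just (vB (inj₂ 1F))
    ε₂-bot' : ∀ (e : Kept (ε ∷ [])) → proj₁ e ≡ ε₂ → bot B (eB (inj₁ e)) ≡ just (vB (inj₂ 2F))
    ε₃-bot' : ∀ (e : Kept (ε ∷ [])) → proj₁ e ≡ ε₃ → bot B (eB (inj₁ e)) ≡ just (vB (inj₂ 0F))

-- (2) interaction i (lower edges ε₃, ε) above cocontraction d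
--     (upper edge ε, lower edges ε₁ ε₂)  ⟶  contraction n0 (lower ε₃, upper δ₁ δ₂),
--     interactions n1 (lower ε₁ δ₁), n2 (lower ε₂ δ₂).
record Rule2 (A B : Flow) : Set where
  field
    i d : Fin (V A)
    ε ε₁ ε₂ ε₃ : Fin (E A)
    i-kind : kind A i ≡ interaction
    d-kind : kind A d ≡ cocontraction
    ε-top  : top A ε ≡ just i
    ε-bot  : bot A ε ≡ just d
    ε₃-top : top A ε₃ ≡ just i
    ε₃≢ε   : ε₃ ≢ ε
    ε₁-top : top A ε₁ ≡ just d
    ε₂-top : top A ε₂ ≡ just d
    ε₁≢ε₂  : ε₁ ≢ ε₂
    rep    : Replacement A B (i ∷ d ∷ []) (ε ∷ []) 3 2
  open Replacement rep
  field
    n0-kind : kind B (vB (inj₂ 0F)) ≡ contraction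
    n1-kind : kind B (vB (inj₂ 1F)) ≡ interaction
    n2-kind : kind B (vB (inj₂ 2F)) ≡ interaction
    δ₁-top  : top B (eB (inj₂ 0F)) ≡ just (vB (inj₂ 1F))
    δ₁-bot  : bot B (eB (inj₂ 0F)) ≡ just (vB (inj₂ 0F))
    δ₂-top  : top B (eB (inj₂ 1F)) ≡ just (vB (inj₂ 2F))
    δ₂-bot  : bot B (eB (inj₂ 1F)) ≡ just (vB (inj₂ 0F))
    ε₃-top' : ∀ (e : Kept (ε ∷ [])) → proj₁ e ≡ ε₃ → top B (eB (inj₁ e)) ≡ just (vB (inj₂ 0F))
    ε₁-top' : ∀ (e : Kept (ε ∷ [])) → proj₁ e ≡ ε₁ → top B (eB (inj₁ e)) ≡ just (vB (inj₂ 1F))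
    ε₂-top' : ∀ (e : Kept (ε ∷ [])) → proj₁ e ≡ ε₂ → top B (eB (inj₁ e)) ≡ just (vB (inj₂ 2F))

-- (3) contraction c (upper ε₁ ε₂, lower ε) above cocontraction d
--     (upper ε, lower ε₃ ε₄)  ⟶  cocontractions n0 (upper ε₁), n1 (upper ε₂),
--     contractions n2 (lower ε₃), n3 (lower ε₄), and new edges
--     n0→n2, n0→n3, n1→n2, n1→n3.
record Rule3 (A B : Flow) : Set where
  field
    c d : Fin (V A)
    ε ε₁ ε₂ ε₃ ε₄ : Fin (E A)
    c-kind : kind A c ≡ contraction
    d-kind : kind A d ≡ cocontraction
    ε-top  : top A ε ≡ just c
    ε-bot  : bot A ε ≡ just d
    ε₁-bot : bot A ε₁ ≡ just c
    ε₂-bot : bot A ε₂ ≡ just c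
    ε₁≢ε₂  : ε₁ ≢ ε₂
    ε₃-top : top A ε₃ ≡ just d
    ε₄-top : top A ε₄ ≡ just d
    ε₃≢ε₄  : ε₃ ≢ ε₄
    rep    : Replacement A B (c ∷ d ∷ []) (ε ∷ []) 4 4
  open Replacement rep
  field
    n0-kind : kind B (vB (inj₂ 0F)) ≡ cocontraction
    n1-kind : kind B (vB (inj₂ 1F)) ≡ cocontraction
    n2-kind : kind B (vB (inj₂ 2F)) ≡ contraction
    n3-kind : kind B (vB (inj₂ 3F)) ≡ contraction
    δ₀-top  : top B (eB (inj₂ 0F)) ≡ just (vB (inj₂ 0F))
    δ₀-bot  : bot B (eB (inj₂ 0F)) ≡ just (vB (inj₂ 2F))
    δ₁-top  : top B (eB (inj₂ 1F)) ≡ just (vB (inj₂ 0F))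
    δ₁-bot  : bot B (eB (inj₂ 1F)) ≡ just (vB (inj₂ 3F))
    δ₂-top  : top B (eB (inj₂ 2F)) ≡ just (vB (inj₂ 1F))
    δ₂-bot  : bot B (eB (inj₂ 2F)) ≡ just (vB (inj₂ 2F))
    δ₃-top  : top B (eB (inj₂ 3F)) ≡ just (vB (inj₂ 1F))
    δ₃-bot  : bot B (eB (inj₂ 3F)) ≡ just (vB (inj₂ 3F))
    ε₁-bot' : ∀ (e : Kept (ε ∷ [])) → proj₁ e ≡ ε₁ → bot B (eB (inj₁ e)) ≡ just (vB (inj₂ 0F))
    ε₂-bot' : ∀ (e : Kept (ε ∷ [])) → proj₁ e ≡ ε₂ → bot B (eB (inj₁ e)) ≡ just (vB (inj₂ 1F))
    ε₃-top' : ∀ (e : Kept (ε ∷ [])) → proj₁ e ≡ ε₃ → top B (eB (inj₁ e)) ≡ just (vB (inj₂ 2F))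
    ε₄-top' : ∀ (e : Kept (ε ∷ [])) → proj₁ e ≡ ε₄ → top B (eB (inj₁ e)) ≡ just (vB (inj₂ 3F))

data _⟶c_ (A B : Flow) : Set where
  rule1 : Rule1 A B → A ⟶c B
  rule2 : Rule2 A B → A ⟶c B
  rule3 : Rule3 A B → A ⟶c B

_⟶c⋆_ : Flow → Flow → Set
_⟶c⋆_ = Star _⟶c_

module Submission where

-- An ai-cycle in the result B of one step A ⟶c B is transported back to
-- an ai-cycle in A.  Since joins of ai-paths nest arbitrarily, we first
-- show that ai-cycles are the same as closed WALKS with distinct edges: a
-- walk is a sequence of edge traversals where consecutive traversals keep
-- their direction or turn at a (co)interaction vertex between distinct
-- edges.  A SIMULATION of B in A maps traversals and vertices of B to A
-- respecting ends and these junction conditions, hence closed walks to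
-- closed walks; as every closed walk can be shortcut to one with distinct
-- edges, simulations reflect ai-cycles.  Each rule yields a simulation:
-- kept vertices and edges map to themselves, new vertices to the redex
-- vertex they replace, new edges to the redex edge.  Junctions at kept
-- vertices are preserved uniformly; those at new vertices are checked
-- rule by rule from the arities of the redex.

open import Defs
open import Data.Nat using (ℕ)
open import Data.Fin using (Fin; _≟_; suc) renaming (zero to 0F)
open import Data.Fin.Properties using (suc-injective)
open import Data.Fin.Patterns using (1F; 2F; 3F)
open import Data.Maybe using (Maybe; just; nothing)
open import Data.Maybe.Properties using (just-injective)
open import Function.Base using (_∘_)
open import Function.Bundles using (Inverse; Injection)
open import Function.Properties.Inverse using (↔⇒↣)
open import Data.List using (List; []; _∷_; _∷ʳ_; _++_; reverse; length; filter; allFin)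
open import Data.List.Properties using (++-assoc; unfold-reverse; reverse-involutive; ∷ʳ-injectiveʳ; ∷-injectiveˡ)
open import Data.List.Relation.Unary.Unique.Propositional using (Unique)
open import Data.List.Relation.Unary.AllPairs using ([]; _∷_)
open import Data.List.Relation.Unary.All using ([]; _∷_)
import Data.List.Relation.Unary.All.Properties as All
open import Data.List.Relation.Unary.Any using (here; there)
open import Data.List.Membership.Propositional.Properties using (∈-allFin; ∈-filter⁺)
open import Data.List.Membership.Propositional using (_∈_; _∉_)
import Data.List.Membership.DecPropositional as DecMembership
open import Data.Bool using (Bool; true; false; T; not)
open import Data.Bool.Properties using (T-irrelevant) renaming (_≟_ to _≟ᵇ_)
open import Data.Product using (Σ; ∃; _×_; _,_; proj₁; proj₂)
open import Data.Sum using (_⊎_; inj₁; inj₂; swap)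
open import Data.Sum.Properties using (inj₂-injective)
open import Data.Empty using (⊥; ⊥-elim)
open import Relation.Nullary using (¬_; yes; no)
open import Relation.Binary.PropositionalEquality
  using (_≡_; _≢_; refl; sym; trans; cong; cong₂; subst; subst₂)
open import Relation.Binary.Construct.Closure.ReflexiveTransitive using (_◅_) renaming (ε to done)

open Flow

-- A traversal of an edge: downwards (true) or upwards (false).
Traversal : Flow → Set
Traversal F = Fin (E F) × Bool

src tgt : (F : Flow) → Traversal F → Maybe (Fin (V F))
src F (e , true)  = top F e
src F (e , false) = bot F e
tgt F (e , true)  = bot F e
tgt F (e , false) = top F e

src≡tgt-reversed : ∀ F (t : Traversal F) → src F t ≡ tgt F (proj₁ t , not (proj₂ t))
src≡tgt-reversed F (e , true)  = refl
src≡tgt-reversed F (e , false) = refl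

Junction : (F : Flow) → Fin (V F) → Traversal F → Traversal F → Set
Junction F v t t' = proj₂ t ≡ proj₂ t' ⊎ (IsAI (kind F v) × proj₁ t ≢ proj₁ t')

junction-straight : ∀ F {v t t'} → ¬ IsAI (kind F v) → Junction F v t t' → proj₂ t ≡ proj₂ t'
junction-straight F ¬ai (inj₁ same)   = same
junction-straight F ¬ai (inj₂ (ai , _)) = ⊥-elim (¬ai ai)

junction-turn : ∀ F {v t t'} → proj₂ t ≢ proj₂ t' → Junction F v t t' → proj₁ t ≢ proj₁ t'
junction-turn F differ (inj₁ same)        = ⊥-elim (differ same)
junction-turn F differ (inj₂ (_ , e≢e')) = e≢e'

IsC⇒¬IsAI : ∀ {k} → IsC k → ¬ IsAI k
IsC⇒¬IsAI con ()
IsC⇒¬IsAI cocon ()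

Step : (F : Flow) → Traversal F → Traversal F → Set
Step F t t' = Σ (Fin (V F)) λ v → tgt F t ≡ just v × src F t' ≡ just v × Junction F v t t'

data Walk (F : Flow) : Traversal F → Traversal F → Set where
  one  : ∀ t → Walk F t t
  cons : ∀ {t' u} t → Step F t t' → Walk F t' u → Walk F t u

edges later : ∀ {F t u} → Walk F t u → List (Fin (E F))
edges {t = t} w = proj₁ t ∷ later w
later (one t)      = []
later (cons t s w) = edges w

append : ∀ {F t u x y} → Walk F t u → Step F u x → Walk F x y → Walk F t y
append (one t)       s w₂ = cons t s w₂
append (cons t s' w) s w₂ = cons t s' (append w s w₂)

edges-append : ∀ {F t u x y} (w : Walk F t u) (s : Step F u x) (w₂ : Walk F x y) →
  edges (append w s w₂) ≡ edges w ++ edges w₂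
edges-append (one t)       s w₂ = refl
edges-append (cons t s' w) s w₂ = cong (proj₁ t ∷_) (edges-append w s w₂)

later-snoc : ∀ {F t u x} (w : Walk F t u) (s : Step F u x) →
  later (append w s (one x)) ≡ later w ∷ʳ proj₁ x
later-snoc (one t)       s = refl
later-snoc (cons t s' w) s = cong (_ ∷_) (later-snoc w s)

edges-last : ∀ {F t u} (w : Walk F t u) → ∃ λ init → edges w ≡ init ∷ʳ proj₁ u
edges-last (one t) = [] , refl
edges-last (cons t s w) with edges-last w
... | init , eq = proj₁ t ∷ init , cong (proj₁ t ∷_) eq

-- A closed walk starts and ends at the same vertex; no junction condition
-- is imposed there, matching the definition of ai-cycles.
record ClosedWalk (F : Flow) : Set where
  constructor closed
  field
    {first last} : Traversal F
    walk         : Walk F first last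
    base         : Fin (V F)
    src-first    : src F first ≡ just base
    tgt-last     : tgt F last ≡ just base

SimpleClosedWalk : Flow → Set
SimpleClosedWalk F = Σ (ClosedWalk F) λ c → Unique (edges (ClosedWalk.walk c))

Run : (F : Flow) → Bool → Maybe (Fin (V F)) → Maybe (Fin (V F)) → List (Fin (E F)) → Set
Run F true  x y L = DownPath (top F) (bot F) x y L
Run F false x y L = DownPath (top F) (bot F) y x (reverse L)

data RunThen (F : Flow) (d : Bool) (x y : Maybe (Fin (V F))) (L : List (Fin (E F))) : Set where
  run  : ∀ es e → Run F d x y (es ∷ʳ e) → L ≡ es ∷ʳ e → RunThen F d x y L
  turn : ∀ es e ν f fs → Run F d x (just ν) (es ∷ʳ e) → IsAI (kind F ν) → e ≢ f →
         AIPath F (just ν) y (f ∷ fs) → L ≡ (es ∷ʳ e) ++ (f ∷ fs) → RunThen F d x y L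

runThen⇒aiPath : ∀ {F d x y L} → RunThen F d x y L → AIPath F x y L
runThen⇒aiPath {d = true}  (run es e R refl) = path (inj₁ R)
runThen⇒aiPath {d = false} (run es e R refl) = path (inj₂ R)
runThen⇒aiPath {d = true}  (turn es e ν f fs R ai e≢f P refl) = join (path (inj₁ R)) P ai e≢f
runThen⇒aiPath {d = false} (turn es e ν f fs R ai e≢f P refl) = join (path (inj₂ R)) P ai e≢f

single-run : ∀ {F} (t : Traversal F) → Run F (proj₂ t) (src F t) (tgt F t) ([] ∷ʳ proj₁ t)
single-run (e , true)  = single e
single-run (e , false) = single e

downPath-snoc : ∀ {V E} {top bot : Fin E → Maybe (Fin V)} {x y L w} e →
  DownPath top bot x y L → y ≡ just w → top e ≡ just w → DownPath top bot x (bot e) (L ∷ʳ e)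
downPath-snoc {top = top} {bot} e (single e₁) y≡w top≡w =
  cons e₁ y≡w (subst (λ z → DownPath top bot z (bot e) (e ∷ [])) top≡w (single e))
downPath-snoc e (cons e₁ p D) y≡w top≡w = cons e₁ p (downPath-snoc e D y≡w top≡w)

run-cons : ∀ {F y L v} (t : Traversal F) → tgt F t ≡ just v → Run F (proj₂ t) (just v) y L →
  Run F (proj₂ t) (src F t) y (proj₁ t ∷ L)
run-cons (e , true) p R = cons e p R
run-cons {F} {y} {L} (e , false) p R =
  subst (DownPath (top F) (bot F) y (bot F e)) (sym (unfold-reverse e L)) (downPath-snoc e R refl p)

runThen-cons : ∀ {F y L v} (t : Traversal F) → tgt F t ≡ just v → RunThen F (proj₂ t) (just v) y L →
  RunThen F (proj₂ t) (src F t) y (proj₁ t ∷ L)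
runThen-cons t p (run es e R eq) = run (proj₁ t ∷ es) e (run-cons t p R) (cong (_ ∷_) eq)
runThen-cons t p (turn es e ν f fs R ai e≢f P eq) =
  turn (proj₁ t ∷ es) e ν f fs (run-cons t p R) ai e≢f P (cong (_ ∷_) eq)

-- Every walk is an ai-path: maximal runs of equal direction are paths,
-- and changes of direction are joins at (co)interaction vertices.
walk⇒runThen : ∀ {F t u} (w : Walk F t u) → RunThen F (proj₂ t) (src F t) (tgt F u) (edges w)
walk⇒runThen (one t) = run [] (proj₁ t) (single-run t) refl
walk⇒runThen {F} {t} {u} (cons {t'} t (v , p , q , jn) w) with proj₂ t ≟ᵇ proj₂ t'
... | yes same = runThen-cons t p
      (subst₂ (λ d z → RunThen F d z (tgt F u) (edges w)) (sym same) q (walk⇒runThen w))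
... | no differ with jn
...   | inj₁ same = ⊥-elim (differ same)
...   | inj₂ (ai , e≢f) =
        turn [] (proj₁ t) v (proj₁ t') (later w) (subst (λ z → Run F (proj₂ t) (src F t) z _) p (single-run t))
             ai e≢f (subst (λ z → AIPath F z (tgt F u) (edges w)) q (runThen⇒aiPath (walk⇒runThen w))) refl

walk⇒aiPath : ∀ {F t u} (w : Walk F t u) → AIPath F (src F t) (tgt F u) (edges w)
walk⇒aiPath w = runThen⇒aiPath (walk⇒runThen w)

simpleClosedWalk⇒cycle : ∀ {F} → SimpleClosedWalk F → AICycle F
simpleClosedWalk⇒cycle {F} (closed w v s≡v t≡v , uniq) =
  v , edges w , subst₂ (λ a b → AIPath F a b (edges w)) s≡v t≡v (walk⇒aiPath w) , uniq

record WalkOn (F : Flow) (x y : Maybe (Fin (V F))) (L : List (Fin (E F))) : Set where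
  constructor walkOn
  field
    {first last} : Traversal F
    walk         : Walk F first last
    src-first    : src F first ≡ x
    tgt-last     : tgt F last ≡ y
    edges-walk   : edges walk ≡ L

downPath⇒walk : ∀ {F x y L} → DownPath (top F) (bot F) x y L →
  Σ (WalkOn F x y L) λ w → proj₂ (WalkOn.first w) ≡ true
downPath⇒walk (single e) = walkOn (one (e , true)) refl refl refl , refl
downPath⇒walk (cons e p D) with downPath⇒walk D
... | walkOn {e₁ , .true} w s≡ t≡ es≡ , refl =
  walkOn (cons (e , true) (_ , p , s≡ , inj₁ refl) w) refl t≡ (cong (e ∷_) es≡) , refl

downPath⇒reverseWalk : ∀ {F x y L} → DownPath (top F) (bot F) x y L →
  Σ (WalkOn F y x (reverse L)) λ w → proj₂ (WalkOn.last w) ≡ false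
downPath⇒reverseWalk (single e) = walkOn (one (e , false)) refl refl refl , refl
downPath⇒reverseWalk (cons {es = es} e p D) with downPath⇒reverseWalk D
... | walkOn {last = e₁ , .false} w s≡ t≡ es≡ , refl =
  walkOn (append w (_ , t≡ , p , inj₁ refl) (one _)) s≡ refl
    (trans (edges-append w _ (one _)) (trans (cong (_∷ʳ e) es≡) (sym (unfold-reverse e es)))) , refl

path⇒walk : ∀ {F x y L} → Path F x y L → WalkOn F x y L
path⇒walk (inj₁ D) = proj₁ (downPath⇒walk D)
path⇒walk {L = L} (inj₂ D) with downPath⇒reverseWalk D
... | walkOn w s≡ t≡ es≡ , _ = walkOn w s≡ t≡ (trans es≡ (reverse-involutive L))

-- Every ai-path is a walk: at a join the two edges differ, which is
-- exactly the junction condition at a (co)interaction vertex.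
aiPath⇒walk : ∀ {F x y L} → AIPath F x y L → WalkOn F x y L
aiPath⇒walk (path P) = path⇒walk P
aiPath⇒walk {F} (join {es = es} {e} {f} P₁ P₂ ai e≢f)
  with aiPath⇒walk P₁ | aiPath⇒walk P₂
... | walkOn {last = u} w₁ s₁ t₁ es₁ | walkOn {first = t} w₂ s₂ t₂ es₂ =
  walkOn (append w₁ (_ , t₁ , s₂ , junction) w₂) s₁ t₂
         (trans (edges-append w₁ _ w₂) (cong₂ _++_ es₁ es₂))
  where
    last≡e : proj₁ u ≡ e
    last≡e with edges-last w₁
    ... | init , eq = ∷ʳ-injectiveʳ init es (trans (sym eq) es₁)
    junction : Junction F _ u t
    junction with proj₂ u ≟ᵇ proj₂ t
    ... | yes same = inj₁ same
    ... | no _     = inj₂ (ai , λ eq → e≢f (trans (sym last≡e) (trans eq (∷-injectiveˡ es₂))))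

cycle⇒closedWalk : ∀ {F} → AICycle F → ClosedWalk F
cycle⇒closedWalk (v , es , P , _) with aiPath⇒walk P
... | walkOn w s≡ t≡ _ = closed w v s≡ t≡

unique-++ˡ : ∀ {n} (xs ys : List (Fin n)) → Unique (xs ++ ys) → Unique xs
unique-++ˡ []       ys u        = []
unique-++ˡ (x ∷ xs) ys (x∉ ∷ u) = All.++⁻ˡ xs x∉ ∷ unique-++ˡ xs ys u

unique-middle∉ : ∀ {n} (xs : List (Fin n)) y ys → Unique (xs ++ y ∷ ys) → y ∉ xs
unique-middle∉ (x ∷ xs) y ys (x∉ ∷ u) (here refl) with All.++⁻ʳ xs x∉
... | x≢x ∷ _ = x≢x refl
unique-middle∉ (x ∷ xs) y ys (x∉ ∷ u) (there y∈) = unique-middle∉ xs y ys u y∈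

-- A walk that steps into the reverse of its first traversal closes up
-- once that traversal is dropped (it is not alone: a walk never reverses
-- along a single edge).
drop-first-closes : ∀ {F e d d' s} (P : Walk F (e , d) s) → Step F s (e , d') → d ≢ d' →
  Σ (ClosedWalk F) λ c → edges (ClosedWalk.walk c) ≡ later P
drop-first-closes {F} (one _) (_ , _ , _ , jn) differ = ⊥-elim (junction-turn F differ jn refl)
drop-first-closes {d = true} {false} (cons _ (v' , p' , q' , _) P₂) (v , p , q , _) _ =
  closed P₂ v' q' (trans p (trans (sym q) p')) , refl
drop-first-closes {d = false} {true} (cons _ (v' , p' , q' , _) P₂) (v , p , q , _) _ =
  closed P₂ v' q' (trans p (trans (sym q) p')) , refl
drop-first-closes {d = true}  {true}  (cons _ _ _) _ differ = ⊥-elim (differ refl)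
drop-first-closes {d = false} {false} (cons _ _ _) _ differ = ⊥-elim (differ refl)

-- A walk P from t₀ to s, followed by a step and a walk w,
-- all of whose edges after t₀ are distinct, while the edge of t₀ occurs
-- again in w, contains a simple closed walk: cut at that occurrence.  If
-- it is traversed like t₀ the closed walk is P, otherwise P without t₀.
shortcut-at : ∀ {F t₀ s s₁ u} (P : Walk F t₀ s) → Step F s s₁ → (w : Walk F s₁ u) →
  Unique (later P ++ edges w) → proj₁ t₀ ∈ edges w → SimpleClosedWalk F
shortcut-at {t₀ = e₀ , d₀} {s₁ = .e₀ , d₁} P (v , p , q , jn) w U (here refl) with d₀ ≟ᵇ d₁
... | yes refl = closed P v q p ,
      (All.¬Any⇒All¬ (later P) (unique-middle∉ (later P) e₀ (later w) U) ∷ unique-++ˡ (later P) (edges w) U)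
... | no differ with drop-first-closes P (v , p , q , jn) differ
...   | c , edges≡ = c , subst Unique (sym edges≡) (unique-++ˡ (later P) (edges w) U)
shortcut-at P s (one _) U (there ())
shortcut-at {s₁ = s₁} P s (cons _ s' w) U (there e₀∈) =
  shortcut-at (append P s (one _)) s' w
    (subst Unique (trans (sym (++-assoc (later P) (proj₁ s₁ ∷ []) (edges w)))
                         (cong (_++ edges w) (sym (later-snoc P s)))) U) e₀∈

shortcut : ∀ {F t u} (w : Walk F t u) → Unique (edges w) ⊎ SimpleClosedWalk F
shortcut (one t) = inj₁ ([] ∷ [])
shortcut (cons t s w) with shortcut w
... | inj₂ c = inj₂ c
... | inj₁ U with DecMembership._∈?_ _≟_ (proj₁ t) (edges w)
...   | yes t∈ = inj₂ (shortcut-at (one t) s w U t∈)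
...   | no  t∉ = inj₁ (All.¬Any⇒All¬ (edges w) t∉ ∷ U)

closedWalk⇒cycle : ∀ {F} → ClosedWalk F → AICycle F
closedWalk⇒cycle c@(closed w _ _ _) with shortcut w
... | inj₁ U = simpleClosedWalk⇒cycle (c , U)
... | inj₂ c' = simpleClosedWalk⇒cycle c'

record Simulation (A B : Flow) : Set where
  field
    φ : Traversal B → Traversal A
    ψ : Fin (V B) → Fin (V A)
    src-sim : ∀ t v → src B t ≡ just v → src A (φ t) ≡ just (ψ v)
    tgt-sim : ∀ t v → tgt B t ≡ just v → tgt A (φ t) ≡ just (ψ v)
    junction-sim : ∀ t t' v → tgt B t ≡ just v → src B t' ≡ just v →
                   Junction B v t t' → Junction A (ψ v) (φ t) (φ t')

  walk-sim : ∀ {t u} → Walk B t u → Walk A (φ t) (φ u)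
  walk-sim (one t) = one (φ t)
  walk-sim (cons t (v , p , q , jn) w) =
    cons (φ t) (ψ v , tgt-sim _ v p , src-sim _ v q , junction-sim _ _ v p q jn) (walk-sim w)

  closedWalk-sim : ClosedWalk B → ClosedWalk A
  closedWalk-sim (closed w v s≡v t≡v) = closed (walk-sim w) (ψ v) (src-sim _ v s≡v) (tgt-sim _ v t≡v)

simulation-cycleFree : ∀ {A B} → Simulation A B → CycleFree A → CycleFree B
simulation-cycleFree S cfA cycle =
  cfA (closedWalk⇒cycle (Simulation.closedWalk-sim S (cycle⇒closedWalk cycle)))

length0-∉ : ∀ {X : Set} {x : X} (L : List X) → length L ≡ 0 → x ∉ L
length0-∉ [] _ ()

length1-∈ : ∀ {X : Set} {x a : X} (L : List X) → length L ≡ 1 → a ∈ L → x ∈ L → x ≡ a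
length1-∈ (p ∷ []) _ (here refl) (here refl) = refl

∈-pair : ∀ {X : Set} {x p q : X} → x ∈ p ∷ q ∷ [] → x ≡ p ⊎ x ≡ q
∈-pair (here x≡p)          = inj₁ x≡p
∈-pair (there (here x≡q)) = inj₂ x≡q

length2-∈ : ∀ {X : Set} {x a b : X} (L : List X) → length L ≡ 2 → a ∈ L → b ∈ L → a ≢ b →
  x ∈ L → x ≡ a ⊎ x ≡ b
length2-∈ (p ∷ q ∷ []) _ a∈ b∈ a≢b x∈ with ∈-pair a∈ | ∈-pair b∈
... | inj₁ refl | inj₁ refl = ⊥-elim (a≢b refl)
... | inj₁ refl | inj₂ refl = ∈-pair x∈
... | inj₂ refl | inj₁ refl = swap (∈-pair x∈)
... | inj₂ refl | inj₂ refl = ⊥-elim (a≢b refl)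

module Arity (F : Flow) where
  private
    ∈-ending-at : ∀ (end : Fin (E F) → Maybe (Fin (V F))) {v e} → end e ≡ just v →
      e ∈ filter (λ e → end e ≟ᵐ just v) (allFin (E F))
    ∈-ending-at end = ∈-filter⁺ (λ e → end e ≟ᵐ just _) (∈-allFin _)

  no-lower-edge : ∀ {v e} → lowArity (kind F v) ≡ 0 → top F e ≡ just v → ⊥
  no-lower-edge {v} ar h = length0-∉ _ (trans (lower-arity F v) ar) (∈-ending-at (top F) h)

  no-upper-edge : ∀ {v e} → upArity (kind F v) ≡ 0 → bot F e ≡ just v → ⊥
  no-upper-edge {v} ar h = length0-∉ _ (trans (upper-arity F v) ar) (∈-ending-at (bot F) h)

  lower-edge-unique : ∀ {v a e} → lowArity (kind F v) ≡ 1 → top F a ≡ just v → top F e ≡ just v → e ≡ a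
  lower-edge-unique {v} ar ha h =
    length1-∈ _ (trans (lower-arity F v) ar) (∈-ending-at (top F) ha) (∈-ending-at (top F) h)

  upper-edge-unique : ∀ {v a e} → upArity (kind F v) ≡ 1 → bot F a ≡ just v → bot F e ≡ just v → e ≡ a
  upper-edge-unique {v} ar ha h =
    length1-∈ _ (trans (upper-arity F v) ar) (∈-ending-at (bot F) ha) (∈-ending-at (bot F) h)

  lower-edge-pair : ∀ {v a b e} → lowArity (kind F v) ≡ 2 → top F a ≡ just v → top F b ≡ just v → a ≢ b →
    top F e ≡ just v → e ≡ a ⊎ e ≡ b
  lower-edge-pair {v} ar ha hb a≢b h = length2-∈ _ (trans (lower-arity F v) ar)
    (∈-ending-at (top F) ha) (∈-ending-at (top F) hb) a≢b (∈-ending-at (top F) h)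

  upper-edge-pair : ∀ {v a b e} → upArity (kind F v) ≡ 2 → bot F a ≡ just v → bot F b ≡ just v → a ≢ b →
    bot F e ≡ just v → e ≡ a ⊎ e ≡ b
  upper-edge-pair {v} ar ha hb a≢b h = length2-∈ _ (trans (upper-arity F v) ar)
    (∈-ending-at (bot F) ha) (∈-ending-at (bot F) hb) a≢b (∈-ending-at (bot F) h)

kept-or-deleted : ∀ {n} (w : Fin n) xs → T (not (memb w xs)) ⊎ T (memb w xs)
kept-or-deleted w xs with memb w xs
... | true  = inj₂ _
... | false = inj₁ _

deleted-pair : ∀ {n} (w a b : Fin n) → T (memb w (a ∷ b ∷ [])) → w ≡ a ⊎ w ≡ b
deleted-pair w a b h with w ≟ a | w ≟ b
... | yes w≡a | _       = inj₁ w≡a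
... | no _    | yes w≡b = inj₂ w≡b

kept-≢ : ∀ {n} {a : Fin n} (ke : Kept (a ∷ [])) → proj₁ ke ≢ a
kept-≢ {a = a} (e , e-kept) e≡a with e ≟ a
... | no e≢a = e≢a e≡a

kept-injective : ∀ {n} (xs : List (Fin n)) {a b : Kept xs} → proj₁ a ≡ proj₁ b → a ≡ b
kept-injective xs {x , p} {.x , q} refl = cong (x ,_) (T-irrelevant p q)

module ReplacementSimulation
  {A B : Flow} {redV : List (Fin (V A))} {redE : List (Fin (E A))} {nV nE : ℕ}
  (rep : Replacement A B redV redE nV nE)
  (newV : Fin nV → Fin (V A))
  (newE : Fin nE → Bool → Traversal A)
  (top-redex : ∀ ke w → top A (proj₁ ke) ≡ just w → T (memb w redV) →
     Σ (Fin nV) λ i → top B (Replacement.eB rep (inj₁ ke)) ≡ just (Replacement.vB rep (inj₂ i)) × newV i ≡ w)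
  (bot-redex : ∀ ke w → bot A (proj₁ ke) ≡ just w → T (memb w redV) →
     Σ (Fin nV) λ i → bot B (Replacement.eB rep (inj₁ ke)) ≡ just (Replacement.vB rep (inj₂ i)) × newV i ≡ w)
  (newE-src : ∀ j d → Σ (Fin nV) λ i →
     src B (Replacement.eB rep (inj₂ j) , d) ≡ just (Replacement.vB rep (inj₂ i)) × src A (newE j d) ≡ just (newV i))
  (newE-tgt : ∀ j d → Σ (Fin nV) λ i →
     tgt B (Replacement.eB rep (inj₂ j) , d) ≡ just (Replacement.vB rep (inj₂ i)) × tgt A (newE j d) ≡ just (newV i))
  where
  open Replacement rep

  vB-injective : ∀ {y y'} → just (vB y) ≡ just (vB y') → y ≡ y'
  vB-injective eq = Injection.injective (↔⇒↣ isoV) (just-injective eq)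

  new-injective : ∀ {i i'} → just (vB (inj₂ i)) ≡ just (vB (inj₂ i')) → i ≡ i'
  new-injective eq = inj₂-injective (vB-injective eq)

  new≢kept : ∀ {i w} → just (vB (inj₂ i)) ≢ just (vB (inj₁ w))
  new≢kept eq with vB-injective eq
  ... | ()

  data VertexView : Fin (V B) → Set where
    as-vB : ∀ y → VertexView (vB y)

  vertexView : ∀ v → VertexView v
  vertexView v = subst VertexView (Inverse.strictlyInverseˡ isoV v) (as-vB _)

  data TraversalView : Traversal B → Set where
    as-eB : ∀ x d → TraversalView (eB x , d)

  traversalView : ∀ t → TraversalView t
  traversalView (b , d) = subst (λ b → TraversalView (b , d)) (Inverse.strictlyInverseˡ isoE b) (as-eB _ d)

  ψ' : Kept redV ⊎ Fin nV → Fin (V A)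
  ψ' (inj₁ w) = proj₁ w
  ψ' (inj₂ i) = newV i

  φ' : Kept redE ⊎ Fin nE → Bool → Traversal A
  φ' (inj₁ ke) d = proj₁ ke , d
  φ' (inj₂ j)  d = newE j d

  ψ : Fin (V B) → Fin (V A)
  ψ v = ψ' (Inverse.from isoV v)

  φ : Traversal B → Traversal A
  φ (b , d) = φ' (Inverse.from isoE b) d

  kept-end : (endA : Fin (E A) → Maybe (Fin (V A))) (endB : Fin (E B) → Maybe (Fin (V B))) →
    (∀ ke → endA (proj₁ ke) ≡ nothing → endB (eB (inj₁ ke)) ≡ nothing) →
    (∀ ke w → endA (proj₁ ke) ≡ just (proj₁ w) → endB (eB (inj₁ ke)) ≡ just (vB (inj₁ w))) →
    (∀ ke w → endA (proj₁ ke) ≡ just w → T (memb w redV) →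
       Σ (Fin nV) λ i → endB (eB (inj₁ ke)) ≡ just (vB (inj₂ i)) × newV i ≡ w) →
    ∀ ke y → endB (eB (inj₁ ke)) ≡ just (vB y) → endA (proj₁ ke) ≡ just (ψ' y)
  kept-end endA endB dangling kept redex ke y h with endA (proj₁ ke) in eq
  ... | nothing with trans (sym (dangling ke eq)) h
  ...   | ()
  kept-end endA endB dangling kept redex ke y h | just w with kept-or-deleted w redV
  ... | inj₁ w-kept = cong just (cong ψ' (vB-injective (trans (sym (kept ke (w , w-kept) eq)) h)))
  ... | inj₂ w-deleted with redex ke w eq w-deleted
  ...   | i , h-new , newVi≡w = cong just (trans (sym newVi≡w) (cong ψ' (vB-injective (trans (sym h-new) h))))

  kept-top : ∀ ke y → top B (eB (inj₁ ke)) ≡ just (vB y) → top A (proj₁ ke) ≡ just (ψ' y)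
  kept-top = kept-end (top A) (top B) top-dang top-kept top-redex

  kept-bot : ∀ ke y → bot B (eB (inj₁ ke)) ≡ just (vB y) → bot A (proj₁ ke) ≡ just (ψ' y)
  kept-bot = kept-end (bot A) (bot B) bot-dang bot-kept bot-redex

  src-sim' : ∀ x d y → src B (eB x , d) ≡ just (vB y) → src A (φ' x d) ≡ just (ψ' y)
  src-sim' (inj₁ ke) true  y h = kept-top ke y h
  src-sim' (inj₁ ke) false y h = kept-bot ke y h
  src-sim' (inj₂ j)  d     y h with newE-src j d
  ... | i , hB , hA rewrite vB-injective (trans (sym h) hB) = hA

  tgt-sim' : ∀ x d y → tgt B (eB x , d) ≡ just (vB y) → tgt A (φ' x d) ≡ just (ψ' y)
  tgt-sim' (inj₁ ke) true  y h = kept-bot ke y h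
  tgt-sim' (inj₁ ke) false y h = kept-top ke y h
  tgt-sim' (inj₂ j)  d     y h with newE-tgt j d
  ... | i , hB , hA rewrite vB-injective (trans (sym h) hB) = hA

  -- At a kept vertex all edges are kept (new edges only meet new
  -- vertices), so junctions there are the same in A and B.
  junction-kept : ∀ x d x' d' w →
    tgt B (eB x , d) ≡ just (vB (inj₁ w)) → src B (eB x' , d') ≡ just (vB (inj₁ w)) →
    Junction B (vB (inj₁ w)) (eB x , d) (eB x' , d') → Junction A (proj₁ w) (φ' x d) (φ' x' d')
  junction-kept (inj₂ j) d x' d' w h h' jn with newE-tgt j d
  ... | i , hB , _ = ⊥-elim (new≢kept (trans (sym hB) h))
  junction-kept (inj₁ ke) d (inj₂ j) d' w h h' jn with newE-src j d'
  ... | i , hB , _ = ⊥-elim (new≢kept (trans (sym hB) h'))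
  junction-kept (inj₁ ke) d (inj₁ ke') d' w h h' (inj₁ same) = inj₁ same
  junction-kept (inj₁ ke) d (inj₁ ke') d' w h h' (inj₂ (ai , e≢e')) =
    inj₂ (subst IsAI (kind-kept w) ai , λ eq → e≢e' (cong (λ ke → eB (inj₁ ke)) (kept-injective redE eq)))

  JunctionsAtNewVertices : Set
  JunctionsAtNewVertices = ∀ i x d x' d' → tgt B (eB x , d) ≡ just (vB (inj₂ i)) →
    src B (eB x' , d') ≡ just (vB (inj₂ i)) → Junction B (vB (inj₂ i)) (eB x , d) (eB x' , d') →
    Junction A (newV i) (φ' x d) (φ' x' d')

  simulation : JunctionsAtNewVertices → Simulation A B
  simulation junction-new = record
    { φ = φ ; ψ = ψ ; src-sim = src-sim ; tgt-sim = tgt-sim ; junction-sim = junction-sim }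
    where
      ψ-vB : ∀ y → ψ (vB y) ≡ ψ' y
      ψ-vB y = cong ψ' (Inverse.strictlyInverseʳ isoV y)
      φ-eB : ∀ x d → φ (eB x , d) ≡ φ' x d
      φ-eB x d = cong (λ x → φ' x d) (Inverse.strictlyInverseʳ isoE x)

      src-sim : ∀ t v → src B t ≡ just v → src A (φ t) ≡ just (ψ v)
      src-sim t v h with traversalView t | vertexView v
      ... | as-eB x d | as-vB y rewrite φ-eB x d | ψ-vB y = src-sim' x d y h

      tgt-sim : ∀ t v → tgt B t ≡ just v → tgt A (φ t) ≡ just (ψ v)
      tgt-sim t v h with traversalView t | vertexView v
      ... | as-eB x d | as-vB y rewrite φ-eB x d | ψ-vB y = tgt-sim' x d y h

      junction-sim : ∀ t t' v → tgt B t ≡ just v → src B t' ≡ just v →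
                     Junction B v t t' → Junction A (ψ v) (φ t) (φ t')
      junction-sim t t' v h h' jn with traversalView t | traversalView t' | vertexView v
      ... | as-eB x d | as-eB x' d' | as-vB y rewrite φ-eB x d | φ-eB x' d' | ψ-vB y with y
      ...   | inj₁ w = junction-kept x d x' d' w h h' jn
      ...   | inj₂ i = junction-new i x d x' d' h h' jn

-- Rule 1: the cocontraction n0 replaces the cointeraction k, and the
-- cointeractions n1, n2 replace the contraction c.  The new edge δⱼ runs
-- from n0 down to n(j+1); it is mapped to ε (from c down to k) traversed
-- in the opposite direction.  So a straight passage through n0 becomes a
-- turn at k between ε₃ and ε, and a turn at n(j+1) between εⱼ and δⱼ
-- becomes a straight passage through c.
module Rule1-simulation {A B : Flow} (r : Rule1 A B) where
  open Rule1 r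
  open Replacement rep using (vB; eB)
  open Arity A

  newV : Fin 3 → Fin (V A)
  newV 0F      = k
  newV (suc _) = c

  newE : Fin 2 → Bool → Traversal A
  newE j d = ε , not d

  εⱼ : Fin 2 → Fin (E A)
  εⱼ 0F = ε₁
  εⱼ 1F = ε₂

  εⱼ-bot' : ∀ j ke → proj₁ ke ≡ εⱼ j → bot B (eB (inj₁ ke)) ≡ just (vB (inj₂ (suc j)))
  εⱼ-bot' 0F = ε₁-bot'
  εⱼ-bot' 1F = ε₂-bot'

  δ-top : ∀ j → top B (eB (inj₂ j)) ≡ just (vB (inj₂ 0F))
  δ-top 0F = δ₁-top
  δ-top 1F = δ₂-top

  δ-bot : ∀ j → bot B (eB (inj₂ j)) ≡ just (vB (inj₂ (suc j)))
  δ-bot 0F = δ₁-bot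
  δ-bot 1F = δ₂-bot

  k-AI : IsAI (kind A k)
  k-AI = subst IsAI (sym k-kind) coint

  upper-of-c : ∀ {e} → bot A e ≡ just c → ∃ λ j → e ≡ εⱼ j
  upper-of-c h with upper-edge-pair (cong upArity c-kind) ε₁-bot ε₂-bot ε₁≢ε₂ h
  ... | inj₁ e≡ε₁ = 0F , e≡ε₁
  ... | inj₂ e≡ε₂ = 1F , e≡ε₂

  kept-upper-of-k : ∀ ke → bot A (proj₁ ke) ≡ just k → proj₁ ke ≡ ε₃
  kept-upper-of-k ke h with upper-edge-pair (cong upArity k-kind) ε-bot ε₃-bot (ε₃≢ε ∘ sym) h
  ... | inj₁ e≡ε  = ⊥-elim (kept-≢ ke e≡ε)
  ... | inj₂ e≡ε₃ = e≡ε₃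

  no-kept-lower : ∀ ke w → top A (proj₁ ke) ≡ just w → w ≡ c ⊎ w ≡ k → ⊥
  no-kept-lower ke w h (inj₁ refl) = kept-≢ ke (lower-edge-unique (cong lowArity c-kind) ε-top h)
  no-kept-lower ke w h (inj₂ refl) = no-lower-edge (cong lowArity k-kind) h

  top-redex : ∀ ke w → top A (proj₁ ke) ≡ just w → T (memb w (c ∷ k ∷ [])) →
    Σ (Fin 3) λ i → top B (eB (inj₁ ke)) ≡ just (vB (inj₂ i)) × newV i ≡ w
  top-redex ke w h w-deleted = ⊥-elim (no-kept-lower ke w h (deleted-pair w c k w-deleted))

  bot-redex : ∀ ke w → bot A (proj₁ ke) ≡ just w → T (memb w (c ∷ k ∷ [])) →
    Σ (Fin 3) λ i → bot B (eB (inj₁ ke)) ≡ just (vB (inj₂ i)) × newV i ≡ w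
  bot-redex ke w h w-deleted with deleted-pair w c k w-deleted
  ... | inj₁ refl with upper-of-c h
  ...   | j , e≡εⱼ = suc j , εⱼ-bot' j ke e≡εⱼ , refl
  bot-redex ke w h w-deleted | inj₂ refl = 0F , ε₃-bot' ke (kept-upper-of-k ke h) , refl

  newE-src : ∀ j d → Σ (Fin 3) λ i →
    src B (eB (inj₂ j) , d) ≡ just (vB (inj₂ i)) × src A (newE j d) ≡ just (newV i)
  newE-src j true  = 0F , δ-top j , ε-bot
  newE-src j false = suc j , δ-bot j , ε-top

  newE-tgt : ∀ j d → Σ (Fin 3) λ i →
    tgt B (eB (inj₂ j) , d) ≡ just (vB (inj₂ i)) × tgt A (newE j d) ≡ just (newV i)
  newE-tgt j true  = newE-src j false
  newE-tgt j false = newE-src j true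

  open ReplacementSimulation rep newV newE top-redex bot-redex newE-src newE-tgt

  data Arrival : Fin 3 → Kept (ε ∷ []) ⊎ Fin 2 → Bool → Set where
    down-ε₃ : ∀ {ke} → proj₁ ke ≡ ε₃ → Arrival 0F (inj₁ ke) true
    up-δ    : ∀ j → Arrival 0F (inj₂ j) false
    down-εⱼ : ∀ j {ke} → proj₁ ke ≡ εⱼ j → Arrival (suc j) (inj₁ ke) true
    down-δ  : ∀ j → Arrival (suc j) (inj₂ j) true

  arrival : ∀ i x d → tgt B (eB x , d) ≡ just (vB (inj₂ i)) → Arrival i x d
  arrival i (inj₂ j) true  h rewrite new-injective (trans (sym h) (δ-bot j)) = down-δ j
  arrival i (inj₂ j) false h rewrite new-injective (trans (sym h) (δ-top j)) = up-δ j
  arrival 0F (inj₁ ke) false h = ⊥-elim (no-kept-lower ke k (kept-top ke (inj₂ 0F) h) (inj₂ refl))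
  arrival (suc j) (inj₁ ke) false h = ⊥-elim (no-kept-lower ke c (kept-top ke (inj₂ (suc j)) h) (inj₁ refl))
  arrival 0F (inj₁ ke) true h = down-ε₃ (kept-upper-of-k ke (kept-bot ke (inj₂ 0F) h))
  arrival (suc j) (inj₁ ke) true h with upper-of-c (kept-bot ke (inj₂ (suc j)) h)
  ... | j' , e≡εⱼ' with suc-injective (new-injective (trans (sym (εⱼ-bot' j' ke e≡εⱼ')) h))
  ...   | refl = down-εⱼ j' e≡εⱼ'

  n0-not-AI : ¬ IsAI (kind B (vB (inj₂ 0F)))
  n0-not-AI = IsC⇒¬IsAI (subst IsC (sym n0-kind) cocon)

  junction-at : ∀ {i x d x'} d' → Arrival i x d → Arrival i x' (not d') →
    Junction B (vB (inj₂ i)) (eB x , d) (eB x' , d') → Junction A (newV i) (φ' x d) (φ' x' d')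
  junction-at true  (down-ε₃ e≡ε₃) (up-δ _) _ = inj₂ (k-AI , λ e≡ε → ε₃≢ε (trans (sym e≡ε₃) e≡ε))
  junction-at false (up-δ _) (down-ε₃ e≡ε₃) _ = inj₂ (k-AI , λ ε≡e → ε₃≢ε (trans (sym e≡ε₃) (sym ε≡e)))
  -- the cocontraction n0 admits no turn
  junction-at false (down-ε₃ _) (down-ε₃ _) jn with junction-straight B n0-not-AI jn
  ... | ()
  junction-at true (up-δ _) (up-δ _) jn with junction-straight B n0-not-AI jn
  ... | ()
  junction-at false (down-εⱼ j _) (down-δ .j) _ = inj₁ refl
  junction-at false (down-δ j) (down-εⱼ .j _) _ = inj₁ refl
  -- no turn back along a single edge
  junction-at false (down-εⱼ j e≡εⱼ) (down-εⱼ .j e'≡εⱼ) jn =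
    ⊥-elim (junction-turn B (λ ()) jn
             (cong (eB ∘ inj₁) (kept-injective (ε ∷ []) (trans e≡εⱼ (sym e'≡εⱼ)))))
  junction-at false (down-δ j) (down-δ .j) jn = ⊥-elim (junction-turn B (λ ()) jn refl)

  -- a departure along (x', d') is an arrival along (x', not d')
  junction-new : JunctionsAtNewVertices
  junction-new i x d x' d' h h' =
    junction-at d' (arrival i x d h)
                   (arrival i x' (not d') (trans (sym (src≡tgt-reversed B (eB x' , d'))) h'))

  rule-simulation : Simulation A B
  rule-simulation = simulation junction-new

-- Rule 2, the upside-down mirror of rule 1: the contraction n0 replaces
-- the interaction i₀, and the interactions n1, n2 replace the
-- cocontraction d₀.  The new edge δⱼ runs from n(j+1) down to n0; it is
-- mapped to ε (from i₀ down to d₀) traversed in the opposite direction.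
module Rule2-simulation {A B : Flow} (r : Rule2 A B) where
  open Rule2 r renaming (i to i₀; d to d₀)
  open Replacement rep using (vB; eB)
  open Arity A

  newV : Fin 3 → Fin (V A)
  newV 0F      = i₀
  newV (suc _) = d₀

  newE : Fin 2 → Bool → Traversal A
  newE j d = ε , not d

  εⱼ : Fin 2 → Fin (E A)
  εⱼ 0F = ε₁
  εⱼ 1F = ε₂

  εⱼ-top' : ∀ j ke → proj₁ ke ≡ εⱼ j → top B (eB (inj₁ ke)) ≡ just (vB (inj₂ (suc j)))
  εⱼ-top' 0F = ε₁-top'
  εⱼ-top' 1F = ε₂-top'

  δ-top : ∀ j → top B (eB (inj₂ j)) ≡ just (vB (inj₂ (suc j)))
  δ-top 0F = δ₁-top
  δ-top 1F = δ₂-top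

  δ-bot : ∀ j → bot B (eB (inj₂ j)) ≡ just (vB (inj₂ 0F))
  δ-bot 0F = δ₁-bot
  δ-bot 1F = δ₂-bot

  i₀-AI : IsAI (kind A i₀)
  i₀-AI = subst IsAI (sym i-kind) int

  lower-of-d₀ : ∀ {e} → top A e ≡ just d₀ → ∃ λ j → e ≡ εⱼ j
  lower-of-d₀ h with lower-edge-pair (cong lowArity d-kind) ε₁-top ε₂-top ε₁≢ε₂ h
  ... | inj₁ e≡ε₁ = 0F , e≡ε₁
  ... | inj₂ e≡ε₂ = 1F , e≡ε₂

  kept-lower-of-i₀ : ∀ ke → top A (proj₁ ke) ≡ just i₀ → proj₁ ke ≡ ε₃
  kept-lower-of-i₀ ke h with lower-edge-pair (cong lowArity i-kind) ε₃-top ε-top ε₃≢ε h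
  ... | inj₁ e≡ε₃ = e≡ε₃
  ... | inj₂ e≡ε  = ⊥-elim (kept-≢ ke e≡ε)

  no-kept-upper : ∀ ke w → bot A (proj₁ ke) ≡ just w → w ≡ i₀ ⊎ w ≡ d₀ → ⊥
  no-kept-upper ke w h (inj₁ refl) = no-upper-edge (cong upArity i-kind) h
  no-kept-upper ke w h (inj₂ refl) = kept-≢ ke (upper-edge-unique (cong upArity d-kind) ε-bot h)

  top-redex : ∀ ke w → top A (proj₁ ke) ≡ just w → T (memb w (i₀ ∷ d₀ ∷ [])) →
    Σ (Fin 3) λ i → top B (eB (inj₁ ke)) ≡ just (vB (inj₂ i)) × newV i ≡ w
  top-redex ke w h w-deleted with deleted-pair w i₀ d₀ w-deleted
  ... | inj₁ refl = 0F , ε₃-top' ke (kept-lower-of-i₀ ke h) , refl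
  ... | inj₂ refl with lower-of-d₀ h
  ...   | j , e≡εⱼ = suc j , εⱼ-top' j ke e≡εⱼ , refl

  bot-redex : ∀ ke w → bot A (proj₁ ke) ≡ just w → T (memb w (i₀ ∷ d₀ ∷ [])) →
    Σ (Fin 3) λ i → bot B (eB (inj₁ ke)) ≡ just (vB (inj₂ i)) × newV i ≡ w
  bot-redex ke w h w-deleted = ⊥-elim (no-kept-upper ke w h (deleted-pair w i₀ d₀ w-deleted))

  newE-src : ∀ j d → Σ (Fin 3) λ i →
    src B (eB (inj₂ j) , d) ≡ just (vB (inj₂ i)) × src A (newE j d) ≡ just (newV i)
  newE-src j true  = suc j , δ-top j , ε-bot
  newE-src j false = 0F , δ-bot j , ε-top

  newE-tgt : ∀ j d → Σ (Fin 3) λ i →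
    tgt B (eB (inj₂ j) , d) ≡ just (vB (inj₂ i)) × tgt A (newE j d) ≡ just (newV i)
  newE-tgt j true  = newE-src j false
  newE-tgt j false = newE-src j true

  open ReplacementSimulation rep newV newE top-redex bot-redex newE-src newE-tgt

  data Arrival : Fin 3 → Kept (ε ∷ []) ⊎ Fin 2 → Bool → Set where
    up-ε₃   : ∀ {ke} → proj₁ ke ≡ ε₃ → Arrival 0F (inj₁ ke) false
    down-δ  : ∀ j → Arrival 0F (inj₂ j) true
    up-εⱼ   : ∀ j {ke} → proj₁ ke ≡ εⱼ j → Arrival (suc j) (inj₁ ke) false
    up-δ    : ∀ j → Arrival (suc j) (inj₂ j) false

  arrival : ∀ i x d → tgt B (eB x , d) ≡ just (vB (inj₂ i)) → Arrival i x d
  arrival i (inj₂ j) true  h rewrite new-injective (trans (sym h) (δ-bot j)) = down-δ j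
  arrival i (inj₂ j) false h rewrite new-injective (trans (sym h) (δ-top j)) = up-δ j
  arrival 0F (inj₁ ke) true h = ⊥-elim (no-kept-upper ke i₀ (kept-bot ke (inj₂ 0F) h) (inj₁ refl))
  arrival (suc j) (inj₁ ke) true h = ⊥-elim (no-kept-upper ke d₀ (kept-bot ke (inj₂ (suc j)) h) (inj₂ refl))
  arrival 0F (inj₁ ke) false h = up-ε₃ (kept-lower-of-i₀ ke (kept-top ke (inj₂ 0F) h))
  arrival (suc j) (inj₁ ke) false h with lower-of-d₀ (kept-top ke (inj₂ (suc j)) h)
  ... | j' , e≡εⱼ' with suc-injective (new-injective (trans (sym (εⱼ-top' j' ke e≡εⱼ')) h))
  ...   | refl = up-εⱼ j' e≡εⱼ'

  n0-not-AI : ¬ IsAI (kind B (vB (inj₂ 0F)))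
  n0-not-AI = IsC⇒¬IsAI (subst IsC (sym n0-kind) con)

  junction-at : ∀ {i x d x'} d' → Arrival i x d → Arrival i x' (not d') →
    Junction B (vB (inj₂ i)) (eB x , d) (eB x' , d') → Junction A (newV i) (φ' x d) (φ' x' d')
  -- passing through n0 in B is turning at i₀ between ε₃ and ε in A
  junction-at false (up-ε₃ e≡ε₃) (down-δ _) _ = inj₂ (i₀-AI , λ e≡ε → ε₃≢ε (trans (sym e≡ε₃) e≡ε))
  junction-at true (down-δ _) (up-ε₃ e≡ε₃) _ = inj₂ (i₀-AI , λ ε≡e → ε₃≢ε (trans (sym e≡ε₃) (sym ε≡e)))
  -- the contraction n0 admits no turn
  junction-at true (up-ε₃ _) (up-ε₃ _) jn with junction-straight B n0-not-AI jn
  ... | ()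
  junction-at false (down-δ _) (down-δ _) jn with junction-straight B n0-not-AI jn
  ... | ()
  -- turning at n(j+1) between εⱼ and δⱼ in B is passing through d₀ in A
  junction-at true (up-εⱼ j _) (up-δ .j) _ = inj₁ refl
  junction-at true (up-δ j) (up-εⱼ .j _) _ = inj₁ refl
  -- no turn back along a single edge
  junction-at true (up-εⱼ j e≡εⱼ) (up-εⱼ .j e'≡εⱼ) jn =
    ⊥-elim (junction-turn B (λ ()) jn
             (cong (eB ∘ inj₁) (kept-injective (ε ∷ []) (trans e≡εⱼ (sym e'≡εⱼ)))))
  junction-at true (up-δ j) (up-δ .j) jn = ⊥-elim (junction-turn B (λ ()) jn refl)

  junction-new : JunctionsAtNewVertices
  junction-new i x d x' d' h h' =
    junction-at d' (arrival i x d h)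
                   (arrival i x' (not d') (trans (sym (src≡tgt-reversed B (eB x' , d'))) h'))

  rule-simulation : Simulation A B
  rule-simulation = simulation junction-new

-- Rule 3: the new (co)contractions n0, n1 replace c and n2, n3 replace d;
-- every new edge is mapped to ε in the same direction.  No new vertex is a
-- (co)interaction and all traversals keep their direction, so junctions at
-- new vertices are straight in B and in A.
module Rule3-simulation {A B : Flow} (r : Rule3 A B) where
  open Rule3 r
  open Replacement rep using (vB; eB)
  open Arity A

  newV : Fin 4 → Fin (V A)
  newV 0F = c
  newV 1F = c
  newV 2F = d
  newV 3F = d

  newE : Fin 4 → Bool → Traversal A
  newE j d = ε , d

  top-redex : ∀ ke w → top A (proj₁ ke) ≡ just w → T (memb w (c ∷ d ∷ [])) →
    Σ (Fin 4) λ i → top B (eB (inj₁ ke)) ≡ just (vB (inj₂ i)) × newV i ≡ w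
  top-redex ke w h w-deleted with deleted-pair w c d w-deleted
  ... | inj₁ refl = ⊥-elim (kept-≢ ke (lower-edge-unique (cong lowArity c-kind) ε-top h))
  ... | inj₂ refl with lower-edge-pair (cong lowArity d-kind) ε₃-top ε₄-top ε₃≢ε₄ h
  ...   | inj₁ e≡ε₃ = 2F , ε₃-top' ke e≡ε₃ , refl
  ...   | inj₂ e≡ε₄ = 3F , ε₄-top' ke e≡ε₄ , refl

  bot-redex : ∀ ke w → bot A (proj₁ ke) ≡ just w → T (memb w (c ∷ d ∷ [])) →
    Σ (Fin 4) λ i → bot B (eB (inj₁ ke)) ≡ just (vB (inj₂ i)) × newV i ≡ w
  bot-redex ke w h w-deleted with deleted-pair w c d w-deleted
  ... | inj₂ refl = ⊥-elim (kept-≢ ke (upper-edge-unique (cong upArity d-kind) ε-bot h))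
  ... | inj₁ refl with upper-edge-pair (cong upArity c-kind) ε₁-bot ε₂-bot ε₁≢ε₂ h
  ...   | inj₁ e≡ε₁ = 0F , ε₁-bot' ke e≡ε₁ , refl
  ...   | inj₂ e≡ε₂ = 1F , ε₂-bot' ke e≡ε₂ , refl

  newE-src : ∀ j d → Σ (Fin 4) λ i →
    src B (eB (inj₂ j) , d) ≡ just (vB (inj₂ i)) × src A (newE j d) ≡ just (newV i)
  newE-src 0F true  = 0F , δ₀-top , ε-top
  newE-src 1F true  = 0F , δ₁-top , ε-top
  newE-src 2F true  = 1F , δ₂-top , ε-top
  newE-src 3F true  = 1F , δ₃-top , ε-top
  newE-src 0F false = 2F , δ₀-bot , ε-bot
  newE-src 1F false = 3F , δ₁-bot , ε-bot
  newE-src 2F false = 2F , δ₂-bot , ε-bot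
  newE-src 3F false = 3F , δ₃-bot , ε-bot

  newE-tgt : ∀ j d → Σ (Fin 4) λ i →
    tgt B (eB (inj₂ j) , d) ≡ just (vB (inj₂ i)) × tgt A (newE j d) ≡ just (newV i)
  newE-tgt j true  = newE-src j false
  newE-tgt j false = newE-src j true

  open ReplacementSimulation rep newV newE top-redex bot-redex newE-src newE-tgt

  new-not-AI : ∀ i → ¬ IsAI (kind B (vB (inj₂ i)))
  new-not-AI 0F = IsC⇒¬IsAI (subst IsC (sym n0-kind) cocon)
  new-not-AI 1F = IsC⇒¬IsAI (subst IsC (sym n1-kind) cocon)
  new-not-AI 2F = IsC⇒¬IsAI (subst IsC (sym n2-kind) con)
  new-not-AI 3F = IsC⇒¬IsAI (subst IsC (sym n3-kind) con)

  direction-kept : ∀ x d → proj₂ (φ' x d) ≡ d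
  direction-kept (inj₁ _) d = refl
  direction-kept (inj₂ _) d = refl

  junction-new : JunctionsAtNewVertices
  junction-new i x d x' d' _ _ jn =
    inj₁ (trans (direction-kept x d) (trans (junction-straight B (new-not-AI i) jn) (sym (direction-kept x' d'))))

  rule-simulation : Simulation A B
  rule-simulation = simulation junction-new

step-cycleFree : ∀ {A B} → A ⟶c B → CycleFree A → CycleFree B
step-cycleFree (rule1 r) = simulation-cycleFree (Rule1-simulation.rule-simulation r)
step-cycleFree (rule2 r) = simulation-cycleFree (Rule2-simulation.rule-simulation r)
step-cycleFree (rule3 r) = simulation-cycleFree (Rule3-simulation.rule-simulation r)

proposition4p17 : ∀ (A B : Flow) → CycleFree A → A ⟶c⋆ B → CycleFree B
proposition4p17 A .A cf done         = cf
proposition4p17 A B  cf (step ◅ rest) = proposition4p17 _ B (step-cycleFree step cf) rest
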